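{- For every integer $n\ge 1$ there exists a finite simple graph $H_n$ with $\eta(H_n)=n$.
   Context: For a vertex $v$ of a finite simple graph $G$, its link is $L(v)=G[N(v)]$. An edge-labeling is a map $l:E(G)\to\mathbb{Z}^+$; the labeled link $L_l(v)$ is $L(v)$ with edges carrying their labels; labeled graphs are isomorphic if there is a label-preserving isomorphism. A labeling is link-irregular if $L_l(u)\not\cong L_l(v)$ for all distinct $u,v\in V(G)$. The link-irregular labeling number $\eta(G)$ is the minimum number of distinct labels used by a link-irregular labeling of $G$, and $\eta(G)=\infty$ if none exists. -}

module Defs where

open import Data.Nat using (ℕ; _<_; _≤_)
import Data.Nat as ℕ
open import Data.Bool using (Bool; true; false; T; if_then_else_)
open import Data.Fin using (Fin)
open import Data.List using (List; []; _∷_; concatMap; length; deduplicate)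
open import Data.List.Base using (allFin)
open import Data.Product using (Σ; _×_; proj₁)
open import Function.Bundles using (_↔_; Inverse)
open import Relation.Binary.PropositionalEquality using (_≡_)
open import Relation.Nullary using (¬_)

record Graph : Set where
  field
    order  : ℕ
    adj    : Fin order → Fin order → Bool
    sym    : ∀ i j → adj i j ≡ adj j i
    irrefl : ∀ i → adj i i ≡ false

open Graph public

-- An edge-labeling with positive integer labels.  It is given as a
-- symmetric function on all pairs of vertices; only its values on
-- edges {i,j} (adj i j ≡ true) are ever used.
record Labeling (G : Graph) : Set where
  field
    lab    : Fin (order G) → Fin (order G) → ℕ
    labSym : ∀ i j → lab i j ≡ lab j i
    labPos : ∀ i j → 0 < lab i j

open Labeling public

Nbhd : (G : Graph) → Fin (order G) → Set
Nbhd G u = Σ (Fin (order G)) (λ w → T (adj G u w))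

record LinkIso (G : Graph) (l : Labeling G) (u v : Fin (order G)) : Set where
  field
    bij      : Nbhd G u ↔ Nbhd G v
  open Inverse bij using (to)
  field
    adjPres  : ∀ (x y : Nbhd G u) →
               adj G (proj₁ (to x)) (proj₁ (to y)) ≡ adj G (proj₁ x) (proj₁ y)
    labPres  : ∀ (x y : Nbhd G u) → T (adj G (proj₁ x) (proj₁ y)) →
               lab l (proj₁ (to x)) (proj₁ (to y)) ≡ lab l (proj₁ x) (proj₁ y)

LinkIrregular : (G : Graph) → Labeling G → Set
LinkIrregular G l = ∀ (u v : Fin (order G)) → ¬ (u ≡ v) → ¬ (LinkIso G l u v)

-- The list of labels on edges (each edge listed from both ends; duplicates
-- are irrelevant since we count distinct values).
edgeLabels : (G : Graph) → Labeling G → List ℕ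
edgeLabels G l =
  concatMap (λ i → concatMap (λ j → if adj G i j then lab l i j ∷ [] else [])
                             (allFin (order G)))
            (allFin (order G))

numLabels : (G : Graph) → Labeling G → ℕ
numLabels G l = length (deduplicate ℕ._≟_ (edgeLabels G l))

-- η(G) = n : the minimum number of distinct labels over link-irregular
-- labelings exists (so η(G) ≠ ∞) and equals n.
η≡ : Graph → ℕ → Set
η≡ G n = Σ (Labeling G) (λ l → LinkIrregular G l × numLabels G l ≡ n)
       × (∀ (l : Labeling G) → LinkIrregular G l → n ≤ numLabels G l)

-- H_n is the disjoint union of n copies of a 7-vertex graph D in which every link contains an
-- edge, the seven links are pairwise non-isomorphic (four first-order properties of a link tell
-- them apart), and the link of vertex 6 is the single edge 0—1.
-- Labelling every edge of the i-th copy by i + 1 is link-irregular with n labels: two links in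
-- one copy already differ as unlabelled graphs, and links in different copies contain edges
-- with different labels.  Conversely, if a labelling gave the edges 0—1 of two copies the same
-- label, then the two copies of vertex 6 would have isomorphic labelled links; so every
-- link-irregular labelling uses at least n labels.

{-# OPTIONS --safe #-}
module Submission where

open import Defs
open import Data.Nat using (ℕ; _≤_)
open import Data.Product using (Σ)

open import Data.Bool using (Bool; true; false; T; _∧_; _∨_; if_then_else_)
import Data.Bool as Bool
open import Data.Bool.Properties using (T-irrelevant; T-∧; ∧-zeroʳ; ∨-comm)
open import Data.Empty using (⊥-elim)
open import Data.Fin using (Fin; zero; suc; toℕ; combine; remQuot)
import Data.Fin as Fin
open import Data.Fin.Patterns using (0F; 1F; 2F; 3F; 4F; 5F; 6F)
open import Data.Fin.Properties
  using (any?; all?; injective⇒≤; toℕ-injective; remQuot-combine; combine-remQuot; combine-injectiveˡ)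
open import Data.List using (List; []; _∷_; map; length; lookup; deduplicate; concatMap; allFin)
open import Data.List.Properties using (map-cong; ≡-dec)
open import Data.List.Membership.Propositional using (_∈_; lose; find)
open import Data.List.Membership.Propositional.Properties
  using (∈-allFin; ∈-lookup; ∈-concatMap⁺; ∈-concatMap⁻; ∈-deduplicate⁺; ∈-deduplicate⁻)
import Data.List.Relation.Unary.All as All
open import Data.List.Relation.Unary.Any using (here; index)
open import Data.List.Relation.Unary.Any.Properties using (lookup-index)
open import Data.List.Relation.Unary.Unique.Propositional using (Unique; _∷_)
open import Data.List.Relation.Unary.Unique.DecPropositional.Properties using (deduplicate-!)
open import Data.Nat using (suc; _*_; _⊔_; s≤s; z≤n)
import Data.Nat as ℕ
open import Data.Nat.Properties using (⊔-comm; ⊔-idem; suc-injective; ≤-antisym)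
open import Data.Product using (_×_; _,_; proj₁; proj₂; ∃; ∃₂)
open import Data.Product.Function.NonDependent.Propositional using (_×-⇔_)
open import Data.Product.Properties using () renaming (≡-dec to ×-≡-dec)
open import Data.Sum using (_⊎_; inj₁; inj₂)
open import Data.Vec.Functional as Vector using (Vector)
open import Function using (_∘_)
open import Function.Bundles using (_↔_; _⇔_; Inverse; Equivalence; mk⇔; mk↔ₛ′)
open import Function.Definitions using (Injective)
open import Function.Properties.Inverse using (↔-sym; ↔-trans)
open import Function.Related.TypeIsomorphisms using (¬-cong-⇔)
open import Relation.Binary.Definitions using (DecidableEquality)
import Relation.Binary.PropositionalEquality as ≡
open import Relation.Binary.PropositionalEquality using (_≡_; refl; cong; cong₂; subst)
open import Relation.Nullary using (Dec; yes; no; does; ¬_; ¬?; _×-dec_)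
open import Relation.Nullary.Decidable
  using (map′; T?; does-⇔; dec-true; decidable-stable; from-yes; _→-dec_; _⊎-dec_)

record LinkIsomorphism (G : Graph) (u : Fin (order G)) (H : Graph) (v : Fin (order H)) : Set where
  field
    bij     : Nbhd G u ↔ Nbhd H v
  open Inverse bij public using (to; from; strictlyInverseˡ; strictlyInverseʳ)
  field
    adjPres : ∀ (x y : Nbhd G u) →
              adj H (proj₁ (to x)) (proj₁ (to y)) ≡ adj G (proj₁ x) (proj₁ y)

LinkIso⇒LinkIsomorphism : ∀ {G l u v} → LinkIso G l u v → LinkIsomorphism G u G v
LinkIso⇒LinkIsomorphism iso = record { bij = LinkIso.bij iso ; adjPres = LinkIso.adjPres iso }

LinkIsomorphism-sym : ∀ {G H : Graph} {u v} → LinkIsomorphism G u H v → LinkIsomorphism H v G u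
LinkIsomorphism-sym {H = H} iso = record
  { bij     = ↔-sym bij
  ; adjPres = λ x y → ≡.trans (≡.sym (adjPres (from x) (from y)))
                        (cong₂ (λ x′ y′ → adj H (proj₁ x′) (proj₁ y′)) (strictlyInverseˡ x) (strictlyInverseˡ y))
  }
  where open LinkIsomorphism iso

LinkIsomorphism-trans : ∀ {F G H t u v} →
                        LinkIsomorphism F t G u → LinkIsomorphism G u H v → LinkIsomorphism F t H v
LinkIsomorphism-trans iso iso′ = record
  { bij     = ↔-trans (LinkIsomorphism.bij iso) (LinkIsomorphism.bij iso′)
  ; adjPres = λ x y → ≡.trans (LinkIsomorphism.adjPres iso′ _ _) (LinkIsomorphism.adjPres iso x y)
  }

LinkIrregular⇒≡ : ∀ {G l} → LinkIrregular G l → ∀ {u v} → LinkIso G l u v → u ≡ v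
LinkIrregular⇒≡ irregular {u} {v} iso = decidable-stable (u Fin.≟ v) (λ u≢v → irregular u v u≢v iso)

-- First-order formulas about a link, with de Bruijn variables (0F is bound by the innermost
-- quantifier) ranging over the vertices of the link; _~_ is adjacency and _≐_ equality.
infix  8 _~_ _≐_
infix  7 ¬ᶠ_
infixr 6 _∧ᶠ_
infixr 5 _∨ᶠ_
infix  4 ∃ᶠ_ ∀ᶠ_

data Formula : ℕ → Set where
  _~_ _≐_ : ∀ {k} → Fin k → Fin k → Formula k
  ¬ᶠ_     : ∀ {k} → Formula k → Formula k
  _∧ᶠ_    : ∀ {k} → Formula k → Formula k → Formula k
  ∃ᶠ_     : ∀ {k} → Formula (suc k) → Formula k

_∨ᶠ_ : ∀ {k} → Formula k → Formula k → Formula k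
φ ∨ᶠ ψ = ¬ᶠ (¬ᶠ φ ∧ᶠ ¬ᶠ ψ)

∀ᶠ_ : ∀ {k} → Formula (suc k) → Formula k
∀ᶠ φ = ¬ᶠ (∃ᶠ ¬ᶠ φ)

hasEdge : Formula 0
hasEdge = ∃ᶠ ∃ᶠ 1F ~ 0F

module _ (G : Graph) (u : Fin (order G)) where

  Nbhd-≡ : {x y : Nbhd G u} → proj₁ x ≡ proj₁ y → x ≡ y
  Nbhd-≡ {w , p} {.w , q} refl = cong (w ,_) (T-irrelevant p q)

  Nbhd-≟ : DecidableEquality (Nbhd G u)
  Nbhd-≟ x y = map′ Nbhd-≡ (cong proj₁) (proj₁ x Fin.≟ proj₁ y)

  any-Nbhd? : {P : Nbhd G u → Set} → (∀ x → Dec (P x)) → Dec (Σ (Nbhd G u) P)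
  any-Nbhd? P? = map′ (λ (w , p , q) → (w , p) , q) (λ ((w , p) , q) → w , p , q)
                      (any? λ w → any-T? (adj G u w) λ p → P? (w , p))
    where
    any-T? : (b : Bool) {Q : T b → Set} → (∀ p → Dec (Q p)) → Dec (Σ (T b) Q)
    any-T? true  Q? = map′ (_ ,_) proj₂ (Q? _)
    any-T? false Q? = no proj₁

  Sat : ∀ {k} → Formula k → Vector (Nbhd G u) k → Set
  Sat (i ~ j)  ρ = T (adj G (proj₁ (ρ i)) (proj₁ (ρ j)))
  Sat (i ≐ j)  ρ = ρ i ≡ ρ j
  Sat (¬ᶠ φ)   ρ = ¬ Sat φ ρ
  Sat (φ ∧ᶠ ψ) ρ = Sat φ ρ × Sat ψ ρ
  Sat (∃ᶠ φ)   ρ = Σ (Nbhd G u) λ x → Sat φ (x Vector.∷ ρ)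

  sat? : ∀ {k} (φ : Formula k) ρ → Dec (Sat φ ρ)
  sat? (i ~ j)  ρ = T? _
  sat? (i ≐ j)  ρ = Nbhd-≟ (ρ i) (ρ j)
  sat? (¬ᶠ φ)   ρ = ¬? (sat? φ ρ)
  sat? (φ ∧ᶠ ψ) ρ = sat? φ ρ ×-dec sat? ψ ρ
  sat? (∃ᶠ φ)   ρ = any-Nbhd? λ x → sat? φ (x Vector.∷ ρ)

  Holds : Formula 0 → Set
  Holds φ = Sat φ Vector.[]

  holds? : ∀ φ → Dec (Holds φ)
  holds? φ = sat? φ Vector.[]

profile : List (Formula 0) → (G : Graph) → Fin (order G) → List Bool
profile φs G u = map (λ φ → does (holds? G u φ)) φs

module _ {G H : Graph} {u : Fin (order G)} {v : Fin (order H)} (iso : LinkIsomorphism G u H v) where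
  open LinkIsomorphism iso
  private module ⇔ = Equivalence

  to-injective : ∀ {x y} → to x ≡ to y → x ≡ y
  to-injective {x} {y} e = ≡.trans (≡.sym (strictlyInverseʳ x)) (≡.trans (cong from e) (strictlyInverseʳ y))

  -- The environments are related pointwise, as x ∷ (to ∘ ρ) and to ∘ (x ∷ ρ) are not
  -- definitionally equal.
  Sat-transport : ∀ {k} (φ : Formula k) {ρ σ} → (∀ i → σ i ≡ to (ρ i)) → Sat G u φ ρ ⇔ Sat H v φ σ
  Sat-transport (i ~ j) {ρ} {σ} σ≗ = mk⇔ (subst T (≡.sym adj-σ)) (subst T adj-σ)
    where
    adj-σ : adj H (proj₁ (σ i)) (proj₁ (σ j)) ≡ adj G (proj₁ (ρ i)) (proj₁ (ρ j))
    adj-σ = ≡.trans (cong₂ (λ x y → adj H (proj₁ x) (proj₁ y)) (σ≗ i) (σ≗ j)) (adjPres (ρ i) (ρ j))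
  Sat-transport (i ≐ j) σ≗ =
    mk⇔ (λ e → ≡.trans (σ≗ i) (≡.trans (cong to e) (≡.sym (σ≗ j))))
        (λ e → to-injective (≡.trans (≡.sym (σ≗ i)) (≡.trans e (σ≗ j))))
  Sat-transport (¬ᶠ φ)   σ≗ = ¬-cong-⇔ (Sat-transport φ σ≗)
  Sat-transport (φ ∧ᶠ ψ) σ≗ = Sat-transport φ σ≗ ×-⇔ Sat-transport ψ σ≗
  Sat-transport (∃ᶠ φ) {ρ} {σ} σ≗ =
    mk⇔ (λ (x , s) → to x , ⇔.to (Sat-transport φ (extend refl)) s)
        (λ (y , s) → from y , ⇔.from (Sat-transport φ (extend (≡.sym (strictlyInverseˡ y)))) s)
    where
    extend : ∀ {x y} → y ≡ to x → ∀ i → (y Vector.∷ σ) i ≡ to ((x Vector.∷ ρ) i)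
    extend y≡ zero    = y≡
    extend y≡ (suc i) = σ≗ i

  Holds-transport : ∀ φ → Holds G u φ ⇔ Holds H v φ
  Holds-transport φ = Sat-transport φ λ ()

  profile-invariant : ∀ φs → profile φs G u ≡ profile φs H v
  profile-invariant = map-cong λ φ → does-⇔ (Holds-transport φ) (holds? G u φ) (holds? H v φ)

lookup-injective : ∀ {A : Set} {xs : List A} → Unique xs → ∀ {p q} → lookup xs p ≡ lookup xs q → p ≡ q
lookup-injective (_  ∷ _) {zero}  {zero}  _ = refl
lookup-injective (x∉ ∷ _) {zero}  {suc q} e = ⊥-elim (All.lookup x∉ (∈-lookup q) e)
lookup-injective (x∉ ∷ _) {suc p} {zero}  e = ⊥-elim (All.lookup x∉ (∈-lookup p) (≡.sym e))
lookup-injective (_  ∷ u) {suc p} {suc q} e = cong suc (lookup-injective u e)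

module _ {A : Set} (_≟_ : DecidableEquality A) where

  ≤-length-deduplicate : ∀ {n xs} (f : Fin n → A) → Injective _≡_ _≡_ f → (∀ i → f i ∈ xs) →
                         n ≤ length (deduplicate _≟_ xs)
  ≤-length-deduplicate {xs = xs} f f-injective f∈xs = injective⇒≤ {f = position} position-injective
    where
    f∈ys : ∀ i → f i ∈ deduplicate _≟_ xs
    f∈ys i = ∈-deduplicate⁺ _≟_ (f∈xs i)
    position : Fin _ → Fin (length (deduplicate _≟_ xs))
    position i = index (f∈ys i)
    position-injective : Injective _≡_ _≡_ position
    position-injective {i} {j} e = f-injective (≡.trans (lookup-index (f∈ys i))
      (≡.trans (cong (lookup (deduplicate _≟_ xs)) e) (≡.sym (lookup-index (f∈ys j)))))

  length-deduplicate-≤ : ∀ {n xs} (f : Fin n → A) → (∀ {y} → y ∈ xs → ∃ λ i → y ≡ f i) →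
                         length (deduplicate _≟_ xs) ≤ n
  length-deduplicate-≤ {xs = xs} f covered = injective⇒≤ {f = preimage} preimage-injective
    where
    preimage-of : ∀ p → ∃ λ i → lookup (deduplicate _≟_ xs) p ≡ f i
    preimage-of p = covered (∈-deduplicate⁻ _≟_ xs (∈-lookup p))
    preimage : Fin (length (deduplicate _≟_ xs)) → Fin _
    preimage p = proj₁ (preimage-of p)
    preimage-injective : Injective _≡_ _≡_ preimage
    preimage-injective {p} {q} e = lookup-injective (deduplicate-! _≟_ xs)
      (≡.trans (proj₂ (preimage-of p)) (≡.trans (cong f e) (≡.sym (proj₂ (preimage-of q)))))

∈-if⁺ : ∀ {A : Set} {c : Bool} {y : A} → T c → y ∈ (if c then y ∷ [] else [])
∈-if⁺ {c = true} _ = here refl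

∈-if⁻ : ∀ {A : Set} {c : Bool} {x y : A} → x ∈ (if c then y ∷ [] else []) → T c × x ≡ y
∈-if⁻ {c = true} (here x≡y) = _ , x≡y

module _ (G : Graph) (l : Labeling G) where

  ∈-edgeLabels⁺ : ∀ {a b} → T (adj G a b) → lab l a b ∈ edgeLabels G l
  ∈-edgeLabels⁺ {a} {b} a~b =
    ∈-concatMap⁺ _ (lose (∈-allFin a) (∈-concatMap⁺ _ (lose (∈-allFin b) (∈-if⁺ a~b))))

  ∈-edgeLabels⁻ : ∀ {y} → y ∈ edgeLabels G l → ∃₂ λ a b → T (adj G a b) × y ≡ lab l a b
  ∈-edgeLabels⁻ y∈ =
    let a , _ , y∈row   = find (∈-concatMap⁻ row {allFin (order G)} y∈)
        b , _ , y∈entry = find (∈-concatMap⁻ (entry a) {allFin (order G)} y∈row)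
    in a , b , ∈-if⁻ y∈entry
    where
    entry : Fin (order G) → Fin (order G) → List ℕ
    entry a b = if adj G a b then lab l a b ∷ [] else []
    row : Fin (order G) → List ℕ
    row a = concatMap (entry a) (allFin (order G))

SoleLinkEdge : (G : Graph) (w x y : Fin (order G)) → Set
SoleLinkEdge G w x y = ∀ s t → T (adj G w s) → T (adj G w t) → T (adj G s t) →
                       (s ≡ x × t ≡ y) ⊎ (s ≡ y × t ≡ x)

-- Vertex combine i s of the graph copies is vertex s of the i-th copy of D.
module Copies (n : ℕ) (D : Graph) where

  copy : Fin (n * order D) → Fin n
  copy a = proj₁ (remQuot {n} (order D) a)

  base : Fin (n * order D) → Fin (order D)
  base a = proj₂ (remQuot {n} (order D) a)

  copies : Graph
  copies = record
    { order  = n * order D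
    ; adj    = λ a b → does (copy a Fin.≟ copy b) ∧ adj D (base a) (base b)
    ; sym    = λ a b → cong₂ _∧_ (does-⇔ (mk⇔ ≡.sym ≡.sym) (copy a Fin.≟ copy b) (copy b Fin.≟ copy a))
                                 (Graph.sym D (base a) (base b))
    ; irrefl = λ a → ≡.trans (cong (does (copy a Fin.≟ copy a) ∧_) (Graph.irrefl D (base a))) (∧-zeroʳ _)
    }

  copy-combine : ∀ (i : Fin n) s → copy (combine i s) ≡ i
  copy-combine i s = cong proj₁ (remQuot-combine i s)

  base-combine : ∀ (i : Fin n) s → base (combine i s) ≡ s
  base-combine i s = cong proj₂ (remQuot-combine i s)

  combine-copy-base : ∀ a → combine (copy a) (base a) ≡ a
  combine-copy-base = combine-remQuot {n} (order D)

  adj-same-copy : ∀ {a b} → copy a ≡ copy b → adj copies a b ≡ adj D (base a) (base b)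
  adj-same-copy {a} {b} e = cong (_∧ adj D (base a) (base b)) (dec-true (copy a Fin.≟ copy b) e)

  adj-combine : ∀ (i : Fin n) s t → adj copies (combine i s) (combine i t) ≡ adj D s t
  adj-combine i s t = ≡.trans (adj-same-copy (≡.trans (copy-combine i s) (≡.sym (copy-combine i t))))
                              (cong₂ (adj D) (base-combine i s) (base-combine i t))

  adj⇒same-copy : ∀ {a b} → T (adj copies a b) → copy a ≡ copy b
  adj⇒same-copy {a} {b} p with copy a Fin.≟ copy b
  ... | yes same = same

  adj⇒adj-base : ∀ {a b} → T (adj copies a b) → T (adj D (base a) (base b))
  adj⇒adj-base {a} {b} p = proj₂ (Equivalence.to (T-∧ {does (copy a Fin.≟ copy b)}) p)

  combine-base-neighbour : ∀ {i s b} → T (adj copies (combine i s) b) → combine i (base b) ≡ b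
  combine-base-neighbour {i} {s} {b} p =
    ≡.trans (cong (λ j → combine j (base b)) (≡.trans (≡.sym (copy-combine i s)) (adj⇒same-copy p)))
            (combine-copy-base b)

  copyIso : ∀ (i : Fin n) s → LinkIsomorphism copies (combine i s) D s
  copyIso i s = record
    { bij     = mk↔ₛ′
        (λ (b , p) → base b , subst (λ t → T (adj D t (base b))) (base-combine i s) (adj⇒adj-base p))
        (λ (t , q) → combine i t , subst T (≡.sym (adj-combine i s t)) q)
        (λ (t , _) → Nbhd-≡ D s (base-combine i t))
        (λ (b , p) → Nbhd-≡ copies (combine i s) (combine-base-neighbour p))
    ; adjPres = λ (_ , p) (_ , q) →
        ≡.sym (adj-same-copy (≡.trans (≡.sym (adj⇒same-copy p)) (adj⇒same-copy q)))
    }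

  vertexIso : ∀ a → LinkIsomorphism copies a D (base a)
  vertexIso a = subst (λ b → LinkIsomorphism copies b D (base a)) (combine-copy-base a)
                      (copyIso (copy a) (base a))

  shiftIso : (l : Labeling copies) (w : Fin (order D)) (i j : Fin n) →
             (∀ s t → T (adj D w s) → T (adj D w t) → T (adj D s t) →
                lab l (combine j s) (combine j t) ≡ lab l (combine i s) (combine i t)) →
             LinkIso copies l (combine i w) (combine j w)
  shiftIso l w i j agree = record
    { bij     = LinkIsomorphism.bij shift
    ; adjPres = LinkIsomorphism.adjPres shift
    ; labPres = λ (a , p) (b , q) a~b →
        ≡.trans (agree (base a) (base b) (w~base p) (w~base q) (adj⇒adj-base a~b))
                (cong₂ (lab l) (combine-base-neighbour p) (combine-base-neighbour q))
    }
    where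
    shift : LinkIsomorphism copies (combine i w) copies (combine j w)
    shift = LinkIsomorphism-trans (copyIso i w) (LinkIsomorphism-sym (copyIso j w))
    w~base : ∀ {a} → T (adj copies (combine i w) a) → T (adj D w (base a))
    w~base p = proj₂ (LinkIsomorphism.to (copyIso i w) (_ , p))

  n≤numLabels : ∀ {w x y} → T (adj D x y) → SoleLinkEdge D w x y →
                (l : Labeling copies) → LinkIrregular copies l → n ≤ numLabels copies l
  n≤numLabels {w} {x} {y} x~y sole l irregular =
    ≤-length-deduplicate ℕ._≟_ label label-injective
      (λ i → ∈-edgeLabels⁺ copies l (subst T (≡.sym (adj-combine i x y)) x~y))
    where
    label : Fin n → ℕ
    label i = lab l (combine i x) (combine i y)
    label-injective : Injective _≡_ _≡_ label
    label-injective {i} {j} e = combine-injectiveˡ i w j w (LinkIrregular⇒≡ irregular (shiftIso l w i j agree))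
      where
      agree : ∀ s t → T (adj D w s) → T (adj D w t) → T (adj D s t) →
              lab l (combine j s) (combine j t) ≡ lab l (combine i s) (combine i t)
      agree s t w~s w~t s~t with sole s t w~s w~t s~t
      ... | inj₁ (refl , refl) = ≡.sym e
      ... | inj₂ (refl , refl) = ≡.trans (labSym l _ _) (≡.trans (≡.sym e) (labSym l _ _))

  -- Edges of the i-th copy get label i + 1; the ⊔ only makes the labelling symmetric on non-edges.
  copyLabeling : Labeling copies
  copyLabeling = record
    { lab    = λ a b → suc (toℕ (copy a) ⊔ toℕ (copy b))
    ; labSym = λ a b → cong suc (⊔-comm (toℕ (copy a)) (toℕ (copy b)))
    ; labPos = λ _ _ → s≤s z≤n
    }

  copyLabeling-edge : ∀ {a b} → T (adj copies a b) → lab copyLabeling a b ≡ suc (toℕ (copy a))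
  copyLabeling-edge {a} a~b =
    cong suc (≡.trans (cong (λ i → toℕ (copy a) ⊔ toℕ i) (≡.sym (adj⇒same-copy a~b))) (⊔-idem (toℕ (copy a))))

  numLabels-copyLabeling≤n : numLabels copies copyLabeling ≤ n
  numLabels-copyLabeling≤n = length-deduplicate-≤ ℕ._≟_ (suc ∘ toℕ) λ y∈ →
    let a , _ , a~b , y≡ = ∈-edgeLabels⁻ copies copyLabeling y∈
    in copy a , ≡.trans y≡ (copyLabeling-edge a~b)

  vertex-≡ : ∀ {a b} → copy a ≡ copy b → base a ≡ base b → a ≡ b
  vertex-≡ {a} {b} e e′ =
    ≡.trans (≡.sym (combine-copy-base a)) (≡.trans (cong₂ combine e e′) (combine-copy-base b))

  LinkIso⇒same-copy : (∀ t → Holds D t hasEdge) →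
                      ∀ {u v} → LinkIso copies copyLabeling u v → copy u ≡ copy v
  LinkIso⇒same-copy edge {u} {v} iso = begin
    copy u              ≡⟨ adj⇒same-copy (proj₂ x) ⟩
    copy (proj₁ x)      ≡⟨ toℕ-injective (suc-injective labels) ⟩
    copy (proj₁ (to x)) ≡⟨ adj⇒same-copy (proj₂ (to x)) ⟨
    copy v              ∎
    where
    open LinkIso iso
    open Inverse bij using (to)
    open ≡.≡-Reasoning
    edge-at-u : Holds copies u hasEdge
    edge-at-u = Equivalence.from (Holds-transport (vertexIso u) hasEdge) (edge (base u))
    x y : Nbhd copies u
    x = proj₁ edge-at-u
    y = proj₁ (proj₂ edge-at-u)
    x~y : T (adj copies (proj₁ x) (proj₁ y))
    x~y = proj₂ (proj₂ edge-at-u)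
    labels : suc (toℕ (copy (proj₁ x))) ≡ suc (toℕ (copy (proj₁ (to x))))
    labels = begin
      suc (toℕ (copy (proj₁ x)))                     ≡⟨ copyLabeling-edge x~y ⟨
      lab copyLabeling (proj₁ x) (proj₁ y)           ≡⟨ labPres x y x~y ⟨
      lab copyLabeling (proj₁ (to x)) (proj₁ (to y)) ≡⟨ copyLabeling-edge (subst T (≡.sym (adjPres x y)) x~y) ⟩
      suc (toℕ (copy (proj₁ (to x))))                ∎

  copyLabeling-irregular : (φs : List (Formula 0)) → Injective _≡_ _≡_ (profile φs D) →
                           (∀ t → Holds D t hasEdge) → LinkIrregular copies copyLabeling
  copyLabeling-irregular φs profile-injective edge u v u≢v iso =
    u≢v (vertex-≡ (LinkIso⇒same-copy edge iso) (profile-injective (begin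
      profile φs D (base u) ≡⟨ profile-invariant (vertexIso u) φs ⟨
      profile φs copies u   ≡⟨ profile-invariant (LinkIso⇒LinkIsomorphism iso) φs ⟩
      profile φs copies v   ≡⟨ profile-invariant (vertexIso v) φs ⟩
      profile φs D (base v) ∎)))
    where open ≡.≡-Reasoning

gadgetEdges : List (Fin 7 × Fin 7)
gadgetEdges = (0F , 1F) ∷ (0F , 2F) ∷ (0F , 3F) ∷ (0F , 5F) ∷ (0F , 6F) ∷ (1F , 2F) ∷ (1F , 4F)
            ∷ (1F , 6F) ∷ (2F , 3F) ∷ (2F , 4F) ∷ (2F , 5F) ∷ (3F , 4F) ∷ (3F , 5F) ∷ []

isGadgetEdge : Fin 7 → Fin 7 → Bool
isGadgetEdge i j = does ((i , j) ∈? gadgetEdges)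
  where open import Data.List.Membership.DecPropositional (×-≡-dec Fin._≟_ Fin._≟_) using (_∈?_)

gadgetAdj : Fin 7 → Fin 7 → Bool
gadgetAdj i j = isGadgetEdge i j ∨ isGadgetEdge j i

gadget : Graph
gadget = record
  { order  = 7
  ; adj    = gadgetAdj
  ; sym    = λ i j → ∨-comm (isGadgetEdge i j) (isGadgetEdge j i)
  ; irrefl = from-yes (all? λ i → gadgetAdj i i Bool.≟ false)
  }

atLeastThreeVertices dominatingVertex triangle pendantVertex : Formula 0
atLeastThreeVertices = ∃ᶠ ∃ᶠ ∃ᶠ (¬ᶠ 0F ≐ 1F ∧ᶠ ¬ᶠ 0F ≐ 2F ∧ᶠ ¬ᶠ 1F ≐ 2F)
dominatingVertex     = ∃ᶠ ∀ᶠ (0F ≐ 1F ∨ᶠ 1F ~ 0F)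
triangle             = ∃ᶠ ∃ᶠ ∃ᶠ (0F ~ 1F ∧ᶠ 1F ~ 2F ∧ᶠ 0F ~ 2F)
pendantVertex        = ∃ᶠ ∃ᶠ (1F ~ 0F ∧ᶠ (∀ᶠ 0F ≐ 1F ∨ᶠ ¬ᶠ 2F ~ 0F))

gadgetInvariants : List (Formula 0)
gadgetInvariants = atLeastThreeVertices ∷ dominatingVertex ∷ triangle ∷ pendantVertex ∷ []

gadget-profile-injective : Injective _≡_ _≡_ (profile gadgetInvariants gadget)
gadget-profile-injective {s} {t} = from-yes (all? λ s → all? λ t →
  ≡-dec Bool._≟_ (profile gadgetInvariants gadget s) (profile gadgetInvariants gadget t) →-dec s Fin.≟ t) s t

gadget-hasEdge : ∀ t → Holds gadget t hasEdge
gadget-hasEdge = from-yes (all? λ t → holds? gadget t hasEdge)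

gadget-sole : SoleLinkEdge gadget 6F 0F 1F
gadget-sole = from-yes (all? λ s → all? λ t →
  T? (gadgetAdj 6F s) →-dec T? (gadgetAdj 6F t) →-dec T? (gadgetAdj s t) →-dec
  ((s Fin.≟ 0F ×-dec t Fin.≟ 1F) ⊎-dec (s Fin.≟ 1F ×-dec t Fin.≟ 0F)))

-- For n = 0 the empty graph works as well.
mainTheorem8 : ∀ (n : ℕ) → 1 ≤ n → Σ Graph (λ H → η≡ H n)
mainTheorem8 n _ =
  copies , (copyLabeling , irregular , ≤-antisym numLabels-copyLabeling≤n (lower copyLabeling irregular)) , lower
  where
  open Copies n gadget
  irregular : LinkIrregular copies copyLabeling
  irregular = copyLabeling-irregular gadgetInvariants gadget-profile-injective gadget-hasEdge
  lower : ∀ l → LinkIrregular copies l → n ≤ numLabels copies l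
  lower = n≤numLabels {6F} {0F} {1F} _ gadget-sole
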